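{- Let $\mathsf{JL}$ be a justification logic and $\mathcal{CS}$ a constant specification for $\mathsf{JL}$. Every formula occurring in a $\mathsf{JL}^{\mathcal T}_{\mathcal{CS}}$-tableau proof is a weak $\mathsf{JL}_{\mathcal{CS}}$-subformula of the root of the tableau.
   Context: Language. Justification terms are built from justification variables and constants using binary $\cdot,+$ and unary $!,\bar?,?$; subterms as usual ($s$ is a subterm of $s$, $s+t$, $t+s$, $s\cdot t$, $t\cdot s$, $!s$, $\bar?s$, $?s$, transitively). Formulas: $A ::= p \mid \bot \mid \neg A \mid A\to A \mid t:A$, $p$ from a countable set $\mathcal P$ of propositional variables. Logics. $\mathsf J$ has axiom schemes: all propositional tautologies; $s:A\to(s+t):A$, $s:A\to(t+s):A$; $s:(A\to B)\to(t:A\to(s\cdot t):B)$. Further schemes: jT: $t:A\to A$; jD: $t:\bot\to\bot$; j4: $t:A\to\,!t:t:A$; jB: $\neg A\to\bar{?}t:\neg t:A$; j5: $\neg t:A\to ?t:\neg t:A$. A justification logic $\mathsf{JL}$ is $\mathsf J$ plus any combination of these; its language contains $\cdot,+$ and those of $!,\bar?,?$ occurring in its axioms. A constant specification $\mathcal{CS}$ for $\mathsf{JL}$ is a downward closed set of formulas $c_{i_n}:\dots:c_{i_1}:A$ ($n\ge1$, constants $c_{i_j}$, $A$ an axiom instance of $\mathsf{JL}$): if $c_{i_n}:c_{i_{n-1}}:\dots:c_{i_1}:A\in\mathcal{CS}$, $n\ge2$, then $c_{i_{n-1}}:\dots:c_{i_1}:A\in\mathcal{CS}$. Subformulas. "$A$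 is a $\mathsf{JL}_{\mathcal{CS}}$-subformula of $B$" is the least relation such that: $A=B$; or $B=\neg F$ and $A$ is one of $F$; or $B=F\to G$ and $A$ is one of $F$ or of $G$; or $B=t:F$ and $A$ is one of $F$; or $A=t:F$ where $t$ is a subterm of a term occurring in $B$ and $F$ is one of $B$; or $A$ is one of some $c_{i_n}:\dots:c_{i_1}:F\in\mathcal{CS}$; closed under transitivity. $A$ is a weak $\mathsf{JL}_{\mathcal{CS}}$-subformula of $B$ if $A$ is a $\mathsf{JL}_{\mathcal{CS}}$-subformula of $B$ or the negation of one. $\mathsf{JL}^{\mathcal T}_{\mathcal{CS}}$-tableaux. A tableau for $F$ has root $\neg F$, extended by rule applications whose premises lie on the extended branch. Rules: $(F\neg)$: $\neg\neg A$ / $A$; $(F\to)$: $\neg(A\to B)$ / $A,\neg B$; $(T\to)$: $A\to B$ / $\neg A$ | $B$; $(F+_L)$: $\neg(t+s):A$ / $\neg t:A$; $(F+_R)$: $\neg(t+s):A$ / $\neg s:A$; $(T\cdot)$: from $s:(A\to B)$ and $t:A$ on the branch add $(s\cdot t):B$, provided all three are $\mathsf{JL}_{\mathcal{CS}}$-subformulas of the root; $(PB)$: split into $A$ | $\neg A$, provided $A$ is a $\mathsf{JL}_{\mathcal{CS}}$-subformula of the root. Additionally: with jT, $(T:)$: $t:A$ / $A$; with jD, $(T:_\bot)$: $t:\bot$ / $\bot$; with j4, $(F!)$: $\neg!t:t:A$ / $\neg t:A$; with jB, $(F\bar?)$: $\neg\bar?t:\neg t:A$ / $A$; with j5, $(F?)$: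 $\neg?t:\neg t:A$ / $t:A$. A branch closes if it contains $A$ and $\neg A$, or $\bot$, or $\neg c:F$ with $c:F\in\mathcal{CS}$; a tableau is closed if all branches close. A $\mathsf{JL}^{\mathcal T}_{\mathcal{CS}}$-tableau proof of $F$ is a closed $\mathsf{JL}^{\mathcal T}_{\mathcal{CS}}$-tableau with root $\neg F$. -}

module Defs where

open import Data.Nat using (ℕ)
open import Data.Bool using (Bool; true; false; _∧_; not; _∨_)
open import Data.List using (List; []; _∷_; _++_)
open import Data.List.Membership.Propositional using (_∈_)
open import Data.Product using (Σ; ∃; _×_; _,_)
open import Data.Sum using (_⊎_)
open import Relation.Binary.PropositionalEquality using (_≡_)

infixr 6 _⇒_
infixr 7 _∶_
infixl 8 _·_
infixl 8 _⊕_

data Tm : Set where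
  jvar   : ℕ → Tm
  jconst : ℕ → Tm
  _·_    : Tm → Tm → Tm
  _⊕_    : Tm → Tm → Tm
  !_     : Tm → Tm
  ¿̄_     : Tm → Tm
  ¿_     : Tm → Tm

data Fm : Set where
  atom : ℕ → Fm
  fls  : Fm
  ¬'_  : Fm → Fm
  _⇒_  : Fm → Fm → Fm
  _∶_  : Tm → Fm → Fm

-- Justification logics: J plus any combination of jT, jD, j4, jB, j5

record JLogic : Set where
  field
    hasT hasD has4 hasB has5 : Bool
open JLogic public

data TmIn (L : JLogic) : Tm → Set where
  jvar   : ∀ {n} → TmIn L (jvar n)
  jconst : ∀ {n} → TmIn L (jconst n)
  app    : ∀ {s t} → TmIn L s → TmIn L t → TmIn L (s · t)
  sum    : ∀ {s t} → TmIn L s → TmIn L t → TmIn L (s ⊕ t)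
  bang   : ∀ {t} → has4 L ≡ true → TmIn L t → TmIn L (! t)
  qbar   : ∀ {t} → hasB L ≡ true → TmIn L t → TmIn L (¿̄ t)
  qm     : ∀ {t} → has5 L ≡ true → TmIn L t → TmIn L (¿ t)

data FmIn (L : JLogic) : Fm → Set where
  atom : ∀ {p} → FmIn L (atom p)
  fls  : FmIn L fls
  neg  : ∀ {A} → FmIn L A → FmIn L (¬' A)
  imp  : ∀ {A B} → FmIn L A → FmIn L B → FmIn L (A ⇒ B)
  just : ∀ {t A} → TmIn L t → FmIn L A → FmIn L (t ∶ A)

-- Propositional tautologies (justification assertions t:A are atoms)

eval : (ℕ → Bool) → (Tm → Fm → Bool) → Fm → Bool
eval v w (atom p) = v p
eval v w fls      = false
eval v w (¬' A)   = not (eval v w A)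
eval v w (A ⇒ B)  = not (eval v w A) ∨ eval v w B
eval v w (t ∶ A)  = w t A

Tautology : Fm → Set
Tautology A = ∀ (v : ℕ → Bool) (w : Tm → Fm → Bool) → eval v w A ≡ true

data AxiomShape (L : JLogic) : Fm → Set where
  taut : ∀ {A} → Tautology A → AxiomShape L A
  sumL : ∀ {s t A} → AxiomShape L ((s ∶ A) ⇒ ((s ⊕ t) ∶ A))
  sumR : ∀ {s t A} → AxiomShape L ((s ∶ A) ⇒ ((t ⊕ s) ∶ A))
  appl : ∀ {s t A B} →
         AxiomShape L ((s ∶ (A ⇒ B)) ⇒ ((t ∶ A) ⇒ ((s · t) ∶ B)))
  jT   : ∀ {t A} → hasT L ≡ true → AxiomShape L ((t ∶ A) ⇒ A)
  jD   : ∀ {t} → hasD L ≡ true → AxiomShape L ((t ∶ fls) ⇒ fls)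
  j4   : ∀ {t A} → has4 L ≡ true → AxiomShape L ((t ∶ A) ⇒ (! t ∶ t ∶ A))
  jB   : ∀ {t A} → hasB L ≡ true →
         AxiomShape L ((¬' A) ⇒ (¿̄ t ∶ ¬' (t ∶ A)))
  j5   : ∀ {t A} → has5 L ≡ true →
         AxiomShape L ((¬' (t ∶ A)) ⇒ (¿ t ∶ ¬' (t ∶ A)))

Axiom : JLogic → Fm → Set
Axiom L A = FmIn L A × AxiomShape L A

data CSForm (L : JLogic) : Fm → Set where
  base : ∀ {c A} → Axiom L A → CSForm L (jconst c ∶ A)
  step : ∀ {c B} → CSForm L B → CSForm L (jconst c ∶ B)

record ConstSpec (L : JLogic) : Set₁ where
  field
    CS       : Fm → Set
    wellform : ∀ {A} → CS A → CSForm L A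
    downward : ∀ {c B} → CS (jconst c ∶ B) → CSForm L B → CS B
open ConstSpec public

data SubTm : Tm → Tm → Set where
  here : ∀ {s} → SubTm s s
  appL : ∀ {s t u} → SubTm s t → SubTm s (t · u)
  appR : ∀ {s t u} → SubTm s u → SubTm s (t · u)
  sumL : ∀ {s t u} → SubTm s t → SubTm s (t ⊕ u)
  sumR : ∀ {s t u} → SubTm s u → SubTm s (t ⊕ u)
  bang : ∀ {s t} → SubTm s t → SubTm s (! t)
  qbar : ∀ {s t} → SubTm s t → SubTm s (¿̄ t)
  qm   : ∀ {s t} → SubTm s t → SubTm s (¿ t)

data TmOcc : Tm → Fm → Set where
  here : ∀ {t A} → TmOcc t (t ∶ A)
  neg  : ∀ {t A} → TmOcc t A → TmOcc t (¬' A)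
  impL : ∀ {t A B} → TmOcc t A → TmOcc t (A ⇒ B)
  impR : ∀ {t A B} → TmOcc t B → TmOcc t (A ⇒ B)
  just : ∀ {t s A} → TmOcc t A → TmOcc t (s ∶ A)

data Sub (L : JLogic) (C : ConstSpec L) : Fm → Fm → Set where
  refl  : ∀ {A} → Sub L C A A
  neg   : ∀ {A F} → Sub L C A F → Sub L C A (¬' F)
  impL  : ∀ {A F G} → Sub L C A F → Sub L C A (F ⇒ G)
  impR  : ∀ {A F G} → Sub L C A G → Sub L C A (F ⇒ G)
  just  : ∀ {A t F} → Sub L C A F → Sub L C A (t ∶ F)
  term  : ∀ {t u F B} → SubTm t u → TmOcc u B → Sub L C F B →
          Sub L C (t ∶ F) B
  cs    : ∀ {A B D} → CS C D → Sub L C A D → Sub L C A B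
  trans : ∀ {A B D} → Sub L C A B → Sub L C B D → Sub L C A D

WeakSub : (L : JLogic) → ConstSpec L → Fm → Fm → Set
WeakSub L C A B = Sub L C A B ⊎ (Σ Fm λ D → (A ≡ ¬' D) × Sub L C D B)

-- Tableaux.  R is the root formula (used for side conditions); the index
-- Γ is the list of formulas on the current branch so far.

data LinRule (L : JLogic) (C : ConstSpec L) (R : Fm) (Γ : List Fm) :
             List Fm → Set where
  F¬   : ∀ {A} → ¬' ¬' A ∈ Γ → LinRule L C R Γ (A ∷ [])
  F⇒   : ∀ {A B} → ¬' (A ⇒ B) ∈ Γ → LinRule L C R Γ (A ∷ ¬' B ∷ [])
  F+L  : ∀ {t s A} → ¬' ((t ⊕ s) ∶ A) ∈ Γ → LinRule L C R Γ (¬' (t ∶ A) ∷ [])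
  F+R  : ∀ {t s A} → ¬' ((t ⊕ s) ∶ A) ∈ Γ → LinRule L C R Γ (¬' (s ∶ A) ∷ [])
  T·   : ∀ {s t A B} → (s ∶ (A ⇒ B)) ∈ Γ → (t ∶ A) ∈ Γ →
         Sub L C (s ∶ (A ⇒ B)) R → Sub L C (t ∶ A) R → Sub L C ((s · t) ∶ B) R →
         LinRule L C R Γ (((s · t) ∶ B) ∷ [])
  T∶   : ∀ {t A} → hasT L ≡ true → (t ∶ A) ∈ Γ → LinRule L C R Γ (A ∷ [])
  T∶⊥  : ∀ {t} → hasD L ≡ true → (t ∶ fls) ∈ Γ → LinRule L C R Γ (fls ∷ [])
  F!   : ∀ {t A} → has4 L ≡ true → ¬' (! t ∶ t ∶ A) ∈ Γ →
         LinRule L C R Γ (¬' (t ∶ A) ∷ [])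
  F¿̄   : ∀ {t A} → hasB L ≡ true → ¬' (¿̄ t ∶ ¬' (t ∶ A)) ∈ Γ →
         LinRule L C R Γ (A ∷ [])
  F¿   : ∀ {t A} → has5 L ≡ true → ¬' (¿ t ∶ ¬' (t ∶ A)) ∈ Γ →
         LinRule L C R Γ ((t ∶ A) ∷ [])

data SplitRule (L : JLogic) (C : ConstSpec L) (R : Fm) (Γ : List Fm) :
               Fm → Fm → Set where
  T⇒ : ∀ {A B} → (A ⇒ B) ∈ Γ → SplitRule L C R Γ (¬' A) B
  PB : ∀ {A} → Sub L C A R → SplitRule L C R Γ A (¬' A)

data Tab (L : JLogic) (C : ConstSpec L) (R : Fm) (Γ : List Fm) : Set where
  stop  : Tab L C R Γ
  lin   : ∀ {Δ} → LinRule L C R Γ Δ → Tab L C R (Δ ++ Γ) → Tab L C R Γ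
  split : ∀ {A B} → SplitRule L C R Γ A B →
          Tab L C R (A ∷ Γ) → Tab L C R (B ∷ Γ) → Tab L C R Γ

data Branch {L : JLogic} {C : ConstSpec L} {R : Fm} :
            {Γ : List Fm} → Tab L C R Γ → List Fm → Set where
  stop   : ∀ {Γ} → Branch {Γ = Γ} stop Γ
  lin    : ∀ {Γ Δ Θ} {r : LinRule L C R Γ Δ} {T : Tab L C R (Δ ++ Γ)} →
           Branch T Θ → Branch (lin r T) Θ
  splitL : ∀ {Γ A B Θ} {r : SplitRule L C R Γ A B}
             {T₁ : Tab L C R (A ∷ Γ)} {T₂ : Tab L C R (B ∷ Γ)} →
           Branch T₁ Θ → Branch (split r T₁ T₂) Θ
  splitR : ∀ {Γ A B Θ} {r : SplitRule L C R Γ A B}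
             {T₁ : Tab L C R (A ∷ Γ)} {T₂ : Tab L C R (B ∷ Γ)} →
           Branch T₂ Θ → Branch (split r T₁ T₂) Θ

ClosedBranch : (L : JLogic) → ConstSpec L → List Fm → Set
ClosedBranch L C Θ =
  (Σ Fm λ A → (A ∈ Θ) × (¬' A ∈ Θ))
  ⊎ (fls ∈ Θ)
  ⊎ (Σ ℕ λ c → Σ Fm λ F → CS C (jconst c ∶ F) × (¬' (jconst c ∶ F) ∈ Θ))

ClosedTab : ∀ {L C R Γ} → Tab L C R Γ → Set
ClosedTab {L} {C} T = ∀ {Θ} → Branch T Θ → ClosedBranch L C Θ

TableauFor : (L : JLogic) → ConstSpec L → Fm → Set
TableauFor L C F = Tab L C (¬' F) (¬' F ∷ [])

Occurs : ∀ {L C R Γ} → Tab L C R Γ → Fm → Set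
Occurs T A = Σ (List Fm) λ Θ → Branch T Θ × (A ∈ Θ)

-- Every tableau rule adds only formulas that are (negated) subformulas of one
-- of its premises, or, for T· and PB, formulas the side condition already
-- requires to be subformulas of the root.  Hence "every formula on the branch
-- is a weak subformula of the root" holds at the root and is preserved by
-- every rule, so it holds along every branch.
module Submission where

open import Defs
open import Data.List.Membership.Propositional using (_∈_)
open import Data.List.Relation.Unary.All using (All; []; _∷_; lookup)
open import Data.List.Relation.Unary.All.Properties using (++⁺)
open import Data.Product using (_×_; _,_; proj₁; proj₂)
open import Data.Sum using (inj₁; inj₂)
open import Relation.Binary.PropositionalEquality using (refl)

module _ {L : JLogic} {C : ConstSpec L} {R : Fm} where

  WeakSubOfRoot : Fm → Set
  WeakSubOfRoot A = WeakSub L C A R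

  SubOfRoot : Fm → Set
  SubOfRoot A = Sub L C A R

  sub⇒weakSub-¬ : ∀ {A} → SubOfRoot A → WeakSubOfRoot (¬' A)
  sub⇒weakSub-¬ s = inj₂ (_ , refl , s)

  weakSub-¬⇒sub : ∀ {A} → WeakSubOfRoot (¬' A) → SubOfRoot A
  weakSub-¬⇒sub (inj₁ s)              = trans (neg refl) s
  weakSub-¬⇒sub (inj₂ (_ , refl , s)) = s

  weakSub-∶⇒sub : ∀ {t A} → WeakSubOfRoot (t ∶ A) → SubOfRoot (t ∶ A)
  weakSub-∶⇒sub (inj₁ s) = s

  weakSub-⇒⇒sub : ∀ {A B} → WeakSubOfRoot (A ⇒ B) → SubOfRoot (A ⇒ B)
  weakSub-⇒⇒sub (inj₁ s) = s

  negatedMember-sub : ∀ {Γ A} → All WeakSubOfRoot Γ → ¬' A ∈ Γ → SubOfRoot A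
  negatedMember-sub ws p = weakSub-¬⇒sub (lookup ws p)

  linRule-weakSub : ∀ {Γ Δ} → LinRule L C R Γ Δ →
                    All WeakSubOfRoot Γ → All WeakSubOfRoot Δ
  linRule-weakSub (F¬ p) ws =
    inj₁ (trans (neg refl) (negatedMember-sub ws p)) ∷ []
  linRule-weakSub (F⇒ p) ws =
    inj₁ (trans (impL refl) (negatedMember-sub ws p))
    ∷ sub⇒weakSub-¬ (trans (impR refl) (negatedMember-sub ws p)) ∷ []
  linRule-weakSub (F+L p) ws =
    sub⇒weakSub-¬ (trans (term (sumL here) here (just refl)) (negatedMember-sub ws p)) ∷ []
  linRule-weakSub (F+R p) ws =
    sub⇒weakSub-¬ (trans (term (sumR here) here (just refl)) (negatedMember-sub ws p)) ∷ []
  linRule-weakSub (T· _ _ _ _ s) _ = inj₁ s ∷ []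
  linRule-weakSub (T∶ _ p) ws =
    inj₁ (trans (just refl) (weakSub-∶⇒sub (lookup ws p))) ∷ []
  linRule-weakSub (T∶⊥ _ p) ws =
    inj₁ (trans (just refl) (weakSub-∶⇒sub (lookup ws p))) ∷ []
  linRule-weakSub (F! _ p) ws =
    sub⇒weakSub-¬ (trans (just refl) (negatedMember-sub ws p)) ∷ []
  linRule-weakSub (F¿̄ _ p) ws =
    inj₁ (trans (just (neg (just refl))) (negatedMember-sub ws p)) ∷ []
  linRule-weakSub (F¿ _ p) ws =
    inj₁ (trans (just (neg refl)) (negatedMember-sub ws p)) ∷ []

  splitRule-weakSub : ∀ {Γ A B} → SplitRule L C R Γ A B → All WeakSubOfRoot Γ →
                      WeakSubOfRoot A × WeakSubOfRoot B
  splitRule-weakSub (T⇒ p) ws =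
    sub⇒weakSub-¬ (trans (impL refl) premise) , inj₁ (trans (impR refl) premise)
    where premise = weakSub-⇒⇒sub (lookup ws p)
  splitRule-weakSub (PB s) _ = inj₁ s , sub⇒weakSub-¬ s

  branch-weakSub : ∀ {Γ Θ} {T : Tab L C R Γ} → Branch T Θ →
                   All WeakSubOfRoot Γ → All WeakSubOfRoot Θ
  branch-weakSub stop ws = ws
  branch-weakSub (lin {r = r} b) ws = branch-weakSub b (++⁺ (linRule-weakSub r ws) ws)
  branch-weakSub (splitL {r = r} b) ws =
    branch-weakSub b (proj₁ (splitRule-weakSub r ws) ∷ ws)
  branch-weakSub (splitR {r = r} b) ws =
    branch-weakSub b (proj₂ (splitRule-weakSub r ws) ∷ ws)

theorem8 : (L : JLogic) (C : ConstSpec L) (F : Fm) → FmIn L F →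
    (T : TableauFor L C F) → ClosedTab T →
    ∀ A → Occurs T A → WeakSub L C A (¬' F)
theorem8 L C F _ T _ A (Θ , b , A∈Θ) = lookup (branch-weakSub b (inj₁ refl ∷ [])) A∈Θ
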